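{- There exists a planar graph $G$ with $\pi_f(G)=5$ (for instance, the wheel on six vertices consisting of a $5$-cycle together with a central vertex adjacent to all five cycle vertices, with its natural plane embedding).
   Context: A sequence $s_1,\dots,s_k,s_1,\dots,s_k$ (with $k\ge 1$) is a repetition; a sequence is nonrepetitive if no block of consecutive terms forms a repetition. For a graph with a fixed embedding in the plane, a facial path is a path consisting of consecutive vertices on the boundary of a face. A facial nonrepetitive vertex coloring is a vertex coloring such that the sequence of colors along every facial path is nonrepetitive. $\pi_f(G)$ is the minimum number of colors in a facial nonrepetitive vertex coloring of the embedded graph $G$. -}

module Defs where

open import Data.Nat using (ℕ; zero; suc; _≤_; _<_)
open import Data.Fin using (Fin)
open import Data.List using (List; []; _∷_; _++_; take; drop; length; map; reverse)
open import Data.List.Membership.Propositional using (_∈_)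
open import Data.Product using (Σ; ∃; _×_; _,_)
open import Data.Sum using (_⊎_)
open import Relation.Binary.PropositionalEquality using (_≡_; _≢_)
open import Relation.Nullary using (¬_)

HasRepetition : {A : Set} → List A → Set
HasRepetition {A} xs =
  Σ (List A) λ pre → Σ (List A) λ mid → Σ (List A) λ post →
    (mid ≢ []) × (xs ≡ pre ++ mid ++ mid ++ post)

Nonrepetitive : {A : Set} → List A → Set
Nonrepetitive xs = ¬ HasRepetition xs

-- A plane graph is given combinatorially by its vertex type together with
-- the list of its faces, each face given by its (cyclic) boundary walk.
window : {V : Set} → List V → ℕ → ℕ → List V
window f i l = take l (drop i f ++ take i f)

IsFacialPath : {V : Set} → List (List V) → List V → Set
IsFacialPath {V} faces p =
  Σ (List V) λ f → (f ∈ faces) ×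
  Σ ℕ λ i → (i < length f) ×
  Σ ℕ λ l → (1 ≤ l) × (l ≤ length f) ×
  ((p ≡ window f i l) ⊎ (p ≡ reverse (window f i l)))

FacialNonrepetitiveColoring : {V C : Set} → List (List V) → (V → C) → Set
FacialNonrepetitiveColoring faces c =
  ∀ p → IsFacialPath faces p → Nonrepetitive (map c p)

PiFEquals : {V : Set} → List (List V) → ℕ → Set
PiFEquals {V} faces k =
  (Σ (V → Fin k) λ c → FacialNonrepetitiveColoring faces c) ×
  (∀ k' → k' < k → ¬ (Σ (V → Fin k') λ c → FacialNonrepetitiveColoring faces c))

-- The wheel on six vertices: rim vertices 0..4 forming a 5-cycle, centre 5.
-- Faces of its natural plane embedding: five triangles and the outer 5-face.
wheelFaces : List (List (Fin 6))
wheelFaces =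
  (0F ∷ 1F ∷ 2F ∷ 3F ∷ 4F ∷ []) ∷
  (5F ∷ 0F ∷ 1F ∷ []) ∷
  (5F ∷ 1F ∷ 2F ∷ []) ∷
  (5F ∷ 2F ∷ 3F ∷ []) ∷
  (5F ∷ 3F ∷ 4F ∷ []) ∷
  (5F ∷ 4F ∷ 0F ∷ []) ∷ []
  where
  open import Data.Fin.Patterns using (0F; 1F; 2F; 3F; 4F; 5F)

module Submission where

-- Repetitions are detected finitely: a sequence has a repetition iff some
-- suffix begins with a nonempty square  s s, and "ys begins with a square of
-- half-length n" is the decidable equation  take n ys ≡ take n (drop n ys).
-- Facial paths are the windows of face boundaries read in either direction,
-- so "every" / "some" facial path reduces to finite quantifiers over faces,
-- starting points and lengths.  Upper bound: the rim colouring 0,1,0,2,3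
-- with centre 4 is checked square-free on every window.  Lower bound: an
-- enumeration of all 4⁶ colourings finds in each a facial path starting
-- with a square; a colouring with k < 5 colours becomes a 4-colouring under
-- an injective renaming of colours, and injective renamings reflect squares.

open import Defs
open import Data.Nat using (ℕ; suc; _≤_; _<_; s≤s; z≤n; s≤s⁻¹)
open import Data.Fin using (Fin; inject≤)
open import Data.Fin.Patterns using (0F; 1F; 2F; 3F; 4F; 5F)
open import Data.Fin.Properties using (all?; inject≤-injective) renaming (_≟_ to _≟ᶠ_)
open import Data.List using (List; []; _∷_; _++_; take; drop; length; map; reverse; tails; applyUpTo; upTo)
open import Data.List.Properties
  using (≡-dec; take++drop≡id; take-map; drop-map; map-injective; map-cong; map-∘; length-++-≤ˡ)
open import Data.List.Relation.Unary.All as All using (All)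
open import Data.List.Relation.Unary.Any as Any using (Any; here; there)
open import Data.List.Membership.Propositional using (_∈_; find; lose)
open import Data.List.Membership.Propositional.Properties using (∈-applyUpTo⁺; ∈-applyUpTo⁻; ∈-upTo⁺; ∈-upTo⁻)
open import Data.Vec as Vec using (Vec; lookup; tabulate)
open import Data.Vec.Properties using (lookup∘tabulate)
open import Data.Product using (Σ; ∃; _×_; _,_)
open import Data.Sum using (inj₁; inj₂)
open import Data.Empty using (⊥; ⊥-elim)
open import Data.Unit using (tt)
open import Function using (_∘_; Injective)
open import Relation.Binary using (DecidableEquality)
open import Relation.Binary.PropositionalEquality
  using (_≡_; _≢_; refl; sym; trans; cong; subst; module ≡-Reasoning)
open import Relation.Nullary using (¬_; Dec; ¬?; _×-dec_; map′)
open import Relation.Nullary.Decidable using (toWitness)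

oneTo : ℕ → List ℕ
oneTo = applyUpTo suc

∈-oneTo⁺ : ∀ {l n} → 1 ≤ l → l ≤ n → l ∈ oneTo n
∈-oneTo⁺ (s≤s z≤n) l≤n = ∈-applyUpTo⁺ suc l≤n

∈-oneTo⁻ : ∀ {l n} → l ∈ oneTo n → 1 ≤ l × l ≤ n
∈-oneTo⁻ l∈ with ∈-applyUpTo⁻ suc l∈
... | _ , k<n , refl = s≤s z≤n , k<n

module Squares {A : Set} where

  take-length-++ : (xs ys : List A) → take (length xs) (xs ++ ys) ≡ xs
  take-length-++ []       ys = refl
  take-length-++ (x ∷ xs) ys = cong (x ∷_) (take-length-++ xs ys)

  drop-length-++ : (xs ys : List A) → drop (length xs) (xs ++ ys) ≡ ys
  drop-length-++ []       ys = refl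
  drop-length-++ (x ∷ xs) ys = drop-length-++ xs ys

  SquareAt : ℕ → List A → Set
  SquareAt n ys = (take n ys ≢ []) × (take n ys ≡ take n (drop n ys))

  HasSquareAtFront : List A → Set
  HasSquareAtFront ys = Any (λ n → SquareAt n ys) (oneTo (length ys))

  SquareFree : List A → Set
  SquareFree xs = All (¬_ ∘ HasSquareAtFront) (tails xs)

  squareAt⇒repetition : ∀ {n ys} → SquareAt n ys → HasRepetition ys
  squareAt⇒repetition {n} {ys} (s≢[] , s≡s′) =
    [] , take n ys , drop n (drop n ys) , s≢[] , split
    where
    open ≡-Reasoning
    split : ys ≡ take n ys ++ take n ys ++ drop n (drop n ys)
    split = begin
      ys                                                    ≡⟨ sym (take++drop≡id n ys) ⟩
      take n ys ++ drop n ys                                ≡⟨ cong (take n ys ++_) (sym (take++drop≡id n (drop n ys))) ⟩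
      take n ys ++ take n (drop n ys) ++ drop n (drop n ys) ≡⟨ cong (λ s → take n ys ++ s ++ drop n (drop n ys)) (sym s≡s′) ⟩
      take n ys ++ take n ys ++ drop n (drop n ys)          ∎

  squareAt-block : (mid post : List A) → mid ≢ [] → SquareAt (length mid) (mid ++ mid ++ post)
  squareAt-block mid post mid≢[] =
    subst (_≢ []) (sym front) mid≢[] , trans front (sym second)
    where
    front : take (length mid) (mid ++ mid ++ post) ≡ mid
    front = take-length-++ mid (mid ++ post)
    second : take (length mid) (drop (length mid) (mid ++ mid ++ post)) ≡ mid
    second = trans (cong (take (length mid)) (drop-length-++ mid (mid ++ post)))
                   (take-length-++ mid post)

  half∈oneTo : (mid post : List A) → mid ≢ [] → length mid ∈ oneTo (length (mid ++ mid ++ post))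
  half∈oneTo []       post mid≢[] = ⊥-elim (mid≢[] refl)
  half∈oneTo (m ∷ ms) post _      = ∈-oneTo⁺ (s≤s z≤n) (s≤s (length-++-≤ˡ ms))

  suffix∈tails : (pre ys : List A) → ys ∈ tails (pre ++ ys)
  suffix∈tails []        ys = here refl
  suffix∈tails (x ∷ pre) ys = there (suffix∈tails pre ys)

  -- A repetition pre ++ mid ++ mid ++ post puts the square mid mid at the
  -- front of the suffix mid ++ mid ++ post, which square-freeness excludes.
  squareFree⇒nonrepetitive : ∀ {xs} → SquareFree xs → Nonrepetitive xs
  squareFree⇒nonrepetitive sf (pre , mid , post , mid≢[] , refl) =
    All.lookup sf (suffix∈tails pre (mid ++ mid ++ post))
      (lose (half∈oneTo mid post mid≢[]) (squareAt-block mid post mid≢[]))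

  module Decide (_≟_ : DecidableEquality A) where

    squareAt? : ∀ n ys → Dec (SquareAt n ys)
    squareAt? n ys = ¬? (≡-dec _≟_ (take n ys) []) ×-dec ≡-dec _≟_ (take n ys) (take n (drop n ys))

    hasSquareAtFront? : ∀ ys → Dec (HasSquareAtFront ys)
    hasSquareAtFront? ys = Any.any? (λ n → squareAt? n ys) (oneTo (length ys))

    squareFree? : ∀ xs → Dec (SquareFree xs)
    squareFree? xs = All.all? (¬? ∘ hasSquareAtFront?) (tails xs)

open Squares

squareAt-injective : ∀ {A B : Set} {f : A → B} → Injective _≡_ _≡_ f →
                     ∀ {n ys} → SquareAt n (map f ys) → SquareAt n ys
squareAt-injective {f = f} f-inj {n} {ys} (s≢[] , s≡s′) =
  (λ s≡[] → s≢[] (trans (take-map n ys) (cong (map f) s≡[]))) , map-injective f-inj images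
  where
  open ≡-Reasoning
  images : map f (take n ys) ≡ map f (take n (drop n ys))
  images = begin
    map f (take n ys)           ≡⟨ sym (take-map n ys) ⟩
    take n (map f ys)           ≡⟨ s≡s′ ⟩
    take n (drop n (map f ys))  ≡⟨ cong (take n) (drop-map n ys) ⟩
    take n (map f (drop n ys))  ≡⟨ take-map n (drop n ys) ⟩
    map f (take n (drop n ys))  ∎

renamedSquare⇒repetition : ∀ {V A B : Set} {c : V → A} {g : V → B} (rename : A → B) →
                           Injective _≡_ _≡_ rename → (∀ x → g x ≡ rename (c x)) →
                           ∀ {p} → HasSquareAtFront (map g p) → HasRepetition (map c p)
renamedSquare⇒repetition rename rename-injective g≗rename∘c {p} square
  with n , squareAt ← Any.satisfied square =
  squareAt⇒repetition (squareAt-injective rename-injective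
    (subst (SquareAt n) (trans (map-cong g≗rename∘c p) (map-∘ p)) squareAt))

module Windows {V : Set} where

  EveryWindow : (List V → Set) → List (List V) → Set
  EveryWindow P faces =
    All (λ f → All (λ i → All (λ l → P (window f i l)) (oneTo (length f))) (upTo (length f))) faces

  SomeWindow : (List V → Set) → List (List V) → Set
  SomeWindow P faces =
    Any (λ f → Any (λ i → Any (λ l → P (window f i l)) (oneTo (length f))) (upTo (length f))) faces

  everyWindow⇒facial : ∀ (P : List V → Set) {faces} →
                       EveryWindow (λ w → P w × P (reverse w)) faces →
                       ∀ {p} → IsFacialPath faces p → P p
  everyWindow⇒facial P every (f , f∈ , i , i< , l , 1≤l , l≤ , _)
    with All.lookup (All.lookup (All.lookup every f∈) (∈-upTo⁺ i<)) (∈-oneTo⁺ 1≤l l≤)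
  everyWindow⇒facial P every (_ , _ , _ , _ , _ , _ , _ , inj₁ refl) | forwards , _ = forwards
  everyWindow⇒facial P every (_ , _ , _ , _ , _ , _ , _ , inj₂ refl) | _ , backwards = backwards

  someWindow⇒facial : ∀ {P : List V → Set} {faces} →
                      SomeWindow P faces → ∃ λ p → IsFacialPath faces p × P p
  someWindow⇒facial some
    with f , f∈ , someStart ← find some
    with i , i∈ , someLength ← find someStart
    with l , l∈ , Pw ← find someLength
    with 1≤l , l≤ ← ∈-oneTo⁻ l∈ =
    window f i l , (f , f∈ , i , ∈-upTo⁻ i∈ , l , 1≤l , l≤ , inj₁ refl) , Pw

  module _ {P : List V → Set} (P? : ∀ w → Dec (P w)) where

    everyWindow? : ∀ faces → Dec (EveryWindow P faces)
    everyWindow? = All.all? (λ f → All.all? (λ i → All.all? (λ l → P? (window f i l))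
                     (oneTo (length f))) (upTo (length f)))

    someWindow? : ∀ faces → Dec (SomeWindow P faces)
    someWindow? = Any.any? (λ f → Any.any? (λ i → Any.any? (λ l → P? (window f i l))
                    (oneTo (length f))) (upTo (length f)))

open Windows

allVectors? : ∀ {k} n {P : Vec (Fin k) n → Set} → (∀ v → Dec (P v)) → Dec (∀ v → P v)
allVectors? 0 P? = map′ (λ { p Vec.[] → p }) (λ all → all Vec.[]) (P? Vec.[])
allVectors? (suc n) P? =
  map′ (λ all → λ { (x Vec.∷ v) → all x v }) (λ all x v → all (x Vec.∷ v))
       (all? (λ x → allVectors? n (λ v → P? (x Vec.∷ v))))

fiveColouring : Fin 6 → Fin 5
fiveColouring 0F = 0F
fiveColouring 1F = 1F
fiveColouring 2F = 0F
fiveColouring 3F = 2F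
fiveColouring 4F = 3F
fiveColouring 5F = 4F

fiveColouring-nonrepetitive : FacialNonrepetitiveColoring wheelFaces fiveColouring
fiveColouring-nonrepetitive p facial =
  squareFree⇒nonrepetitive (everyWindow⇒facial (SquareFree ∘ map fiveColouring) windowsSquareFree facial)
  where
  open Decide _≟ᶠ_
  windowsSquareFree : EveryWindow (λ w → SquareFree (map fiveColouring w) × SquareFree (map fiveColouring (reverse w)))
                                  wheelFaces
  windowsSquareFree = toWitness {a? = everyWindow? (λ w → squareFree? (map fiveColouring w)
                                                   ×-dec squareFree? (map fiveColouring (reverse w))) wheelFaces} tt

fourColouringsHaveSquares : ∀ (v : Vec (Fin 4) 6) → SomeWindow (HasSquareAtFront ∘ map (lookup v)) wheelFaces
fourColouringsHaveSquares =
  toWitness {a? = allVectors? 6 (λ v → someWindow? (hasSquareAtFront? ∘ map (lookup v)) wheelFaces)} tt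
  where open Decide _≟ᶠ_

fewerColoursFail : ∀ k → k < 5 → ¬ (Σ (Fin 6 → Fin k) λ c → FacialNonrepetitiveColoring wheelFaces c)
fewerColoursFail k k<5 (c , nonrepetitive) =
  refute (someWindow⇒facial (fourColouringsHaveSquares (tabulate (rename ∘ c))))
  where
  rename : Fin k → Fin 4
  rename i = inject≤ i (s≤s⁻¹ k<5)
  refute : (∃ λ p → IsFacialPath wheelFaces p × HasSquareAtFront (map (lookup (tabulate (rename ∘ c))) p)) → ⊥
  refute (p , facial , square) =
    nonrepetitive p facial
      (renamedSquare⇒repetition rename (inject≤-injective _ _ _ _) (lookup∘tabulate (rename ∘ c)) square)

mainTheorem2 : PiFEquals wheelFaces 5
mainTheorem2 = (fiveColouring , fiveColouring-nonrepetitive) , fewerColoursFail
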